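{- For all integers $a,b\ge 0$, \[ \sum_{i=0}^{a}\sum_{j=0}^{b}h_{a-i}\,h_{b-j}\,p_{i+j}=(b+1)\,h_a h_b+\sum_{i=1}^{a}(b-a+2i)\,h_{a-i}\,h_{b+i}. \]
   Context: $h_m$ denotes the complete homogeneous symmetric function of degree $m$ (with $h_0=1$) and $p_m$ the power sum symmetric function $\sum_r x_r^m$ for $m\ge1$, with the convention $p_0=1$. -}

module Defs where

open import Algebra.Bundles using (CommutativeRing)
open import Data.Nat using (ℕ; zero; suc; _∸_)
open import Data.Fin using (Fin; zero; suc)
open import Data.Integer using (ℤ; +_; -[1+_])
open import Function using (_∘_)

-- Symmetric functions are realised by evaluation at an arbitrary finite
-- tuple of variables x : Fin n → R in an arbitrary commutative ring R.
module _ {c ℓ} (R : CommutativeRing c ℓ) where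
  open CommutativeRing R using (Carrier; _+_; _*_; -_; 0#; 1#)

  pow : Carrier → ℕ → Carrier
  pow x zero    = 1#
  pow x (suc k) = x * pow x k

  Σ₀ : ℕ → (ℕ → Carrier) → Carrier
  Σ₀ zero    f = f 0
  Σ₀ (suc m) f = Σ₀ m f + f (suc m)

  Σ₁ : ℕ → (ℕ → Carrier) → Carrier
  Σ₁ zero    f = 0#
  Σ₁ (suc m) f = Σ₁ m f + f (suc m)

  ΣFin : (n : ℕ) → (Fin n → Carrier) → Carrier
  ΣFin zero    f = 0#
  ΣFin (suc n) f = f zero + ΣFin n (f ∘ suc)

  fromℕ : ℕ → Carrier
  fromℕ zero    = 0#
  fromℕ (suc k) = 1# + fromℕ k

  fromℤ : ℤ → Carrier
  fromℤ (+ k)    = fromℕ k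
  fromℤ -[1+ k ] = - fromℕ (suc k)

  -- complete homogeneous symmetric polynomial h_m(x_0,…,x_{n-1}):
  -- sum of all monomials of degree m, organised by the exponent k of x_0.
  h : (n : ℕ) → (Fin n → Carrier) → ℕ → Carrier
  h zero    x zero    = 1#
  h zero    x (suc m) = 0#
  h (suc n) x m       = Σ₀ m (λ k → pow (x zero) k * h n (x ∘ suc) (m ∸ k))

  -- power sum p_m = Σ_r x_r^m for m ≥ 1, with p_0 = 1
  p : (n : ℕ) → (Fin n → Carrier) → ℕ → Carrier
  p n x zero    = 1#
  p n x (suc m) = ΣFin n (λ r → pow (x r) (suc m))

{-# OPTIONS --safe #-}
-- Write L(a,b) for the double sum. Peeling off the row i = 0 of L(a+1,b), or the
-- column j = 0 of L(a,b+1), and summing it with Newton's identity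
-- Σ_{k≤m} p_k h_{m-k} = (m+1) h_m leaves in both cases the same remainder
-- Σ_{i≤a} Σ_{j≤b} h_{a-i} h_{b-j} p_{i+j+1}. Hence
--   L(a+1,b) + (a+1) h_a h_{b+1} = L(a,b+1) + (b+1) h_{a+1} h_b,
-- a recurrence that the right-hand side satisfies as well, and at a = 0 both
-- sides are (b+1) h_0 h_b. Newton's identity is proved by induction on the number
-- of variables, from h^{(n+1)}_{m+1} = h^{(n)}_{m+1} + x_0 h^{(n+1)}_m.
module Submission where

open import Defs
open import Algebra.Bundles using (CommutativeRing)
open import Data.Nat using (ℕ; _∸_)
open import Data.Fin using (Fin)
open import Data.Integer as ℤ using (ℤ; +_)
open import Data.Nat as N using (zero; suc; z≤n)
import Data.Fin as F
import Data.Nat.Properties as NP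
import Data.Integer.Properties as ZP
open import Data.Integer.Tactic.RingSolver using (solve-∀)
open import Relation.Binary.PropositionalEquality as ≡ using (_≡_)
open import Function using (_∘_)

κ : ℕ → ℕ → ℕ → ℤ
κ a b i = (+ b) ℤ.- (+ a) ℤ.+ (+ (2 N.* i))

κ-suc-suc : ∀ a b i → κ (suc a) b (suc i) ≡ κ a (suc b) i
κ-suc-suc a b i = ≡.trans (≡.cong (λ k → (+ b) ℤ.- (+ suc a) ℤ.+ (+ k)) (NP.*-suc 2 i))
                          (shift (+ a) (+ b) (+ (2 N.* i)))
  where
  -- + 1 ℤ.+ + a computes to + suc a, so the solver only sees the images of naturals as atoms.
  shift : ∀ A B I → B ℤ.- (+ 1 ℤ.+ A) ℤ.+ (+ 2 ℤ.+ I) ≡ (+ 1 ℤ.+ B) ℤ.- A ℤ.+ I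
  shift = solve-∀

κ-suc-one : ∀ a b → κ (suc a) b 1 ≡ (+ suc (suc b)) ℤ.- (+ suc a)
κ-suc-one a b = shift (+ a) (+ b)
  where
  shift : ∀ A B → B ℤ.- (+ 1 ℤ.+ A) ℤ.+ (+ 2) ≡ (+ 2 ℤ.+ B) ℤ.- (+ 1 ℤ.+ A)
  shift = solve-∀

module _ {ℓ₁ ℓ₂} (R : CommutativeRing ℓ₁ ℓ₂) where
  open CommutativeRing R
  open import Algebra.Properties.Group +-group using (∙-cancelʳ)
  open import Relation.Binary.Reasoning.Setoid setoid
  open import Algebra.Solver.Ring.NaturalCoefficients.Default commutativeSemiring

  fromℕ-1-* : ∀ z → fromℕ R 1 * z ≈ z
  fromℕ-1-* z = trans (*-congʳ (+-identityʳ 1#)) (*-identityˡ z)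

  fromℕ-suc-* : ∀ k z → fromℕ R (suc k) * z ≈ z + fromℕ R k * z
  fromℕ-suc-* k z = trans (distribʳ z 1# (fromℕ R k)) (+-congʳ (*-identityˡ z))

  fromℤ-m-n+n : ∀ m n → fromℤ R ((+ m) ℤ.- (+ n)) + fromℕ R n ≈ fromℕ R m
  fromℤ-m-n+n m       zero    = trans (+-identityʳ _) (reflexive (≡.cong (fromℕ R) (NP.+-identityʳ m)))
  fromℤ-m-n+n zero    (suc n) = -‿inverseˡ _
  fromℤ-m-n+n (suc m) (suc n) = begin
    fromℤ R ((+ suc m) ℤ.- (+ suc n)) + (1# + fromℕ R n)
      ≈⟨ +-congʳ (reflexive (≡.cong (fromℤ R) m+1-[n+1]≡m-n)) ⟩
    fromℤ R ((+ m) ℤ.- (+ n)) + (1# + fromℕ R n)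
      ≈⟨ x+[y+z]≈y+[x+z] _ _ _ ⟩
    1# + (fromℤ R ((+ m) ℤ.- (+ n)) + fromℕ R n)
      ≈⟨ +-congˡ (fromℤ-m-n+n m n) ⟩
    1# + fromℕ R m ∎
    where
    m+1-[n+1]≡m-n : (+ suc m) ℤ.- (+ suc n) ≡ (+ m) ℤ.- (+ n)
    m+1-[n+1]≡m-n = ≡.trans (ZP.[1+m]⊖[1+n]≡m⊖n m n) (≡.sym (ZP.m-n≡m⊖n m n))
    x+[y+z]≈y+[x+z] : ∀ x y z → x + (y + z) ≈ y + (x + z)
    x+[y+z]≈y+[x+z] = solve 3 (λ x y z → x :+ (y :+ z) := y :+ (x :+ z)) refl

  Σ₀-cong-≤ : ∀ m {f g : ℕ → Carrier} → (∀ i → i N.≤ m → f i ≈ g i) → Σ₀ R m f ≈ Σ₀ R m g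
  Σ₀-cong-≤ zero    f≈g = f≈g 0 z≤n
  Σ₀-cong-≤ (suc m) f≈g = +-cong (Σ₀-cong-≤ m (λ i i≤m → f≈g i (NP.m≤n⇒m≤1+n i≤m))) (f≈g (suc m) NP.≤-refl)

  Σ₀-cong : ∀ m {f g : ℕ → Carrier} → (∀ i → f i ≈ g i) → Σ₀ R m f ≈ Σ₀ R m g
  Σ₀-cong m f≈g = Σ₀-cong-≤ m (λ i _ → f≈g i)

  Σ₁-cong : ∀ m {f g : ℕ → Carrier} → (∀ i → f i ≈ g i) → Σ₁ R m f ≈ Σ₁ R m g
  Σ₁-cong zero    f≈g = refl
  Σ₁-cong (suc m) f≈g = +-cong (Σ₁-cong m f≈g) (f≈g (suc m))

  Σ₀-head : ∀ m (f : ℕ → Carrier) → Σ₀ R (suc m) f ≈ f 0 + Σ₀ R m (f ∘ suc)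
  Σ₀-head zero    f = refl
  Σ₀-head (suc m) f = trans (+-congʳ (Σ₀-head m f)) (+-assoc _ _ _)

  Σ₁-head : ∀ m (f : ℕ → Carrier) → Σ₁ R (suc m) f ≈ f 1 + Σ₁ R m (f ∘ suc)
  Σ₁-head zero    f = +-comm _ _
  Σ₁-head (suc m) f = trans (+-congʳ (Σ₁-head m f)) (+-assoc _ _ _)

  Σ₀-distrib-+ : ∀ m (f g : ℕ → Carrier) → Σ₀ R m (λ i → f i + g i) ≈ Σ₀ R m f + Σ₀ R m g
  Σ₀-distrib-+ zero    f g = refl
  Σ₀-distrib-+ (suc m) f g = trans (+-congʳ (Σ₀-distrib-+ m f g)) (+-medial-≈ _ _ _ _)
    where
    +-medial-≈ : ∀ w x y z → (w + x) + (y + z) ≈ (w + y) + (x + z)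
    +-medial-≈ = solve 4 (λ w x y z → (w :+ x) :+ (y :+ z) := (w :+ y) :+ (x :+ z)) refl

  Σ₀-*ˡ : ∀ m k (f : ℕ → Carrier) → Σ₀ R m (λ i → k * f i) ≈ k * Σ₀ R m f
  Σ₀-*ˡ zero    k f = refl
  Σ₀-*ˡ (suc m) k f = trans (+-congʳ (Σ₀-*ˡ m k f)) (sym (distribˡ k _ _))

  infixl 7 _⋆_
  _⋆_ : (ℕ → Carrier) → (ℕ → Carrier) → ℕ → Carrier
  (f ⋆ g) m = Σ₀ R m (λ k → f k * g (m ∸ k))

  ⋆-distribʳ-+ : ∀ (f f′ g : ℕ → Carrier) m → ((λ k → f k + f′ k) ⋆ g) m ≈ (f ⋆ g) m + (f′ ⋆ g) m
  ⋆-distribʳ-+ f f′ g m = trans (Σ₀-cong m (λ k → distribʳ _ _ _)) (Σ₀-distrib-+ m _ _)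

  ⋆-*ˡ : ∀ y (f g : ℕ → Carrier) m → ((λ k → y * f k) ⋆ g) m ≈ y * (f ⋆ g) m
  ⋆-*ˡ y f g m = trans (Σ₀-cong m (λ k → *-assoc _ _ _)) (Σ₀-*ˡ m y _)

  ⋆-suc : ∀ m (f g : ℕ → Carrier) →
          (f ⋆ g) (suc m) ≈ Σ₀ R m (λ k → f k * g (suc (m ∸ k))) + f (suc m) * g 0
  ⋆-suc m f g = +-cong (Σ₀-cong-≤ m (λ k k≤m → reflexive (≡.cong (λ r → f k * g r) (NP.+-∸-assoc 1 k≤m))))
                       (reflexive (≡.cong (λ r → f (suc m) * g r) (NP.n∸n≡0 m)))

  ⋆-preserves-recurrence : ∀ (f : ℕ → Carrier) {g G : ℕ → Carrier} y →
    (∀ r → g (suc r) ≈ G (suc r) + y * g r) → g 0 ≈ G 0 →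
    ∀ m → (f ⋆ g) (suc m) ≈ (f ⋆ G) (suc m) + y * (f ⋆ g) m
  ⋆-preserves-recurrence f {g} {G} y g-rec g₀ m = begin
    (f ⋆ g) (suc m)
      ≈⟨ ⋆-suc m f g ⟩
    Σ₀ R m (λ k → f k * g (suc (m ∸ k))) + f (suc m) * g 0
      ≈⟨ +-cong (Σ₀-cong m (λ k → trans (*-congˡ (g-rec (m ∸ k))) (distribˡ _ _ _))) (*-congˡ g₀) ⟩
    Σ₀ R m (λ k → f k * G (suc (m ∸ k)) + f k * (y * g (m ∸ k))) + f (suc m) * G 0
      ≈⟨ +-congʳ (trans (Σ₀-distrib-+ m _ _) (+-congˡ (Σ₀-cong m (λ k → x*[y*z]≈y*[x*z] _ _ _)))) ⟩
    (Σ₀ R m (λ k → f k * G (suc (m ∸ k))) + Σ₀ R m (λ k → y * (f k * g (m ∸ k)))) + f (suc m) * G 0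
      ≈⟨ +-congʳ (+-congˡ (Σ₀-*ˡ m y _)) ⟩
    (Σ₀ R m (λ k → f k * G (suc (m ∸ k))) + y * (f ⋆ g) m) + f (suc m) * G 0
      ≈⟨ [x+y]+z≈[x+z]+y _ _ _ ⟩
    (Σ₀ R m (λ k → f k * G (suc (m ∸ k))) + f (suc m) * G 0) + y * (f ⋆ g) m
      ≈⟨ +-congʳ (sym (⋆-suc m f G)) ⟩
    (f ⋆ G) (suc m) + y * (f ⋆ g) m ∎
    where
    x*[y*z]≈y*[x*z] : ∀ x y z → x * (y * z) ≈ y * (x * z)
    x*[y*z]≈y*[x*z] = solve 3 (λ x y z → x :* (y :* z) := y :* (x :* z)) refl
    [x+y]+z≈[x+z]+y : ∀ x y z → (x + y) + z ≈ (x + z) + y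
    [x+y]+z≈[x+z]+y = solve 3 (λ x y z → (x :+ y) :+ z := (x :+ z) :+ y) refl

  h-suc-zero : ∀ n x → h R (suc n) x 0 ≈ h R n (x ∘ F.suc) 0
  h-suc-zero n x = *-identityˡ _

  h-suc-suc : ∀ n x r → h R (suc n) x (suc r) ≈ h R n (x ∘ F.suc) (suc r) + x F.zero * h R (suc n) x r
  h-suc-suc n x r = trans (Σ₀-head r _)
    (+-cong (*-identityˡ _) (⋆-*ˡ (x F.zero) (pow R (x F.zero)) (h R n (x ∘ F.suc)) r))

  module _ (n : ℕ) (x : Fin (suc n) → Carrier) where
    private
      y : Carrier
      y = x F.zero
      g G p′ : ℕ → Carrier
      g = h R (suc n) x
      G = h R n (x ∘ F.suc)
      p′ = p R (suc n) x ∘ suc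

    newton-identity⁺-suc : (∀ m → ((p R n (x ∘ F.suc) ∘ suc) ⋆ G) m ≈ fromℕ R (suc m) * G (suc m)) →
                           ∀ m → (p′ ⋆ g) m ≈ fromℕ R (suc m) * g (suc m)
    newton-identity⁺-suc newton-G = go
      where
      p′⋆G : ∀ m → (p′ ⋆ G) m ≈ y * g m + fromℕ R (suc m) * G (suc m)
      p′⋆G m = trans (⋆-distribʳ-+ (λ k → y * pow R y k) (p R n (x ∘ F.suc) ∘ suc) G m)
                     (+-cong (⋆-*ˡ y (pow R y) G m) (newton-G m))

      regroup : ∀ y g G F → (y * g + (G + F * G)) + y * (F * g) ≈ (G + y * g) + F * (G + y * g)
      regroup = solve 4 (λ y g G F → (y :* g :+ (G :+ F :* G)) :+ y :* (F :* g)
                                   := (G :+ y :* g) :+ F :* (G :+ y :* g)) refl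

      go : ∀ m → (p′ ⋆ g) m ≈ fromℕ R (suc m) * g (suc m)
      go zero = begin
        (p′ ⋆ g) 0                 ≈⟨ *-congˡ (h-suc-zero n x) ⟩
        (p′ ⋆ G) 0                 ≈⟨ p′⋆G 0 ⟩
        y * g 0 + fromℕ R 1 * G 1  ≈⟨ trans (+-comm _ _) (+-congʳ (fromℕ-1-* _)) ⟩
        G 1 + y * g 0              ≈⟨ sym (h-suc-suc n x 0) ⟩
        g 1                        ≈⟨ sym (fromℕ-1-* _) ⟩
        fromℕ R 1 * g 1            ∎
      go (suc m) = begin
        (p′ ⋆ g) (suc m)
          ≈⟨ ⋆-preserves-recurrence p′ {g} {G} y (h-suc-suc n x) (h-suc-zero n x) m ⟩
        (p′ ⋆ G) (suc m) + y * (p′ ⋆ g) m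
          ≈⟨ +-cong (p′⋆G (suc m)) (*-congˡ (go m)) ⟩
        (y * g (suc m) + F₂ * G (suc (suc m))) + y * (F₁ * g (suc m))
          ≈⟨ +-congʳ (+-congˡ (fromℕ-suc-* (suc m) _)) ⟩
        (y * g (suc m) + (G (suc (suc m)) + F₁ * G (suc (suc m)))) + y * (F₁ * g (suc m))
          ≈⟨ regroup _ _ _ _ ⟩
        (G (suc (suc m)) + y * g (suc m)) + F₁ * (G (suc (suc m)) + y * g (suc m))
          ≈⟨ sym (fromℕ-suc-* (suc m) _) ⟩
        F₂ * (G (suc (suc m)) + y * g (suc m))
          ≈⟨ *-congˡ (sym (h-suc-suc n x (suc m))) ⟩
        F₂ * g (suc (suc m)) ∎
        where
        F₁ F₂ : Carrier
        F₁ = fromℕ R (suc m)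
        F₂ = fromℕ R (suc (suc m))

  newton-identity⁺ : ∀ n x m → ((p R n x ∘ suc) ⋆ h R n x) m ≈ fromℕ R (suc m) * h R n x (suc m)
  newton-identity⁺ zero    x m = trans (Σ₀-*ˡ m 0# _) (trans (zeroˡ _) (sym (zeroʳ _)))
  newton-identity⁺ (suc n) x   = newton-identity⁺-suc n x (newton-identity⁺ n (x ∘ F.suc))

  newton-identity : ∀ n x m → (p R n x ⋆ h R n x) m ≈ fromℕ R (suc m) * h R n x m
  newton-identity n x zero    = trans (*-identityˡ _) (sym (fromℕ-1-* _))
  newton-identity n x (suc m) = begin
    (p R n x ⋆ h R n x) (suc m)                                ≈⟨ Σ₀-head m _ ⟩
    1# * h R n x (suc m) + ((p R n x ∘ suc) ⋆ h R n x) m       ≈⟨ +-cong (*-identityˡ _) (newton-identity⁺ n x m) ⟩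
    h R n x (suc m) + fromℕ R (suc m) * h R n x (suc m)        ≈⟨ sym (fromℕ-suc-* (suc m) _) ⟩
    fromℕ R (suc (suc m)) * h R n x (suc m)                    ∎

  recurrence-unique : ∀ (F G Q E : ℕ → ℕ → Carrier) →
    (∀ a b → F (suc a) b + Q a b ≈ F a (suc b) + E a b) →
    (∀ a b → G (suc a) b + Q a b ≈ G a (suc b) + E a b) →
    (∀ b → F 0 b ≈ G 0 b) → ∀ a b → F a b ≈ G a b
  recurrence-unique F G Q E F-rec G-rec F₀≈G₀ zero    b = F₀≈G₀ b
  recurrence-unique F G Q E F-rec G-rec F₀≈G₀ (suc a) b = ∙-cancelʳ (Q a b) _ _ (begin
    F (suc a) b + Q a b  ≈⟨ F-rec a b ⟩
    F a (suc b) + E a b  ≈⟨ +-congʳ (recurrence-unique F G Q E F-rec G-rec F₀≈G₀ a (suc b)) ⟩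
    G a (suc b) + E a b  ≈⟨ G-rec a b ⟨
    G (suc a) b + Q a b  ∎)

  module _ (H P : ℕ → Carrier) (newton : ∀ m → (P ⋆ H) m ≈ fromℕ R (suc m) * H m) where

    lhs rhs shifted-lhs : ℕ → ℕ → Carrier
    lhs a b = Σ₀ R a (λ i → Σ₀ R b (λ j → H (a ∸ i) * H (b ∸ j) * P (i N.+ j)))
    rhs a b = fromℕ R (suc b) * H a * H b + Σ₁ R a (λ i → fromℤ R (κ a b i) * H (a ∸ i) * H (b N.+ i))
    shifted-lhs a b = Σ₀ R a (λ i → Σ₀ R b (λ j → H (a ∸ i) * H (b ∸ j) * P (suc (i N.+ j))))

    Σ₀-*-newton : ∀ u m → Σ₀ R m (λ j → u * H (m ∸ j) * P j) ≈ u * (fromℕ R (suc m) * H m)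
    Σ₀-*-newton u m = begin
      Σ₀ R m (λ j → u * H (m ∸ j) * P j)  ≈⟨ Σ₀-cong m (λ j → trans (*-assoc _ _ _) (*-congˡ (*-comm _ _))) ⟩
      Σ₀ R m (λ j → u * (P j * H (m ∸ j))) ≈⟨ Σ₀-*ˡ m u _ ⟩
      u * (P ⋆ H) m                        ≈⟨ *-congˡ (newton m) ⟩
      u * (fromℕ R (suc m) * H m)          ∎

    lhs-sucˡ : ∀ a b → lhs (suc a) b ≈ H (suc a) * (fromℕ R (suc b) * H b) + shifted-lhs a b
    lhs-sucˡ a b = trans (Σ₀-head a _) (+-congʳ (Σ₀-*-newton (H (suc a)) b))

    lhs-sucʳ : ∀ a b → lhs a (suc b) ≈ H (suc b) * (fromℕ R (suc a) * H a) + shifted-lhs a b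
    lhs-sucʳ a b = begin
      lhs a (suc b)
        ≈⟨ Σ₀-cong a (λ i → Σ₀-head b _) ⟩
      Σ₀ R a (λ i → H (a ∸ i) * H (suc b) * P (i N.+ 0)
                    + Σ₀ R b (λ j → H (a ∸ i) * H (b ∸ j) * P (i N.+ suc j)))
        ≈⟨ Σ₀-cong a (λ i → +-cong (column i) (Σ₀-cong b (λ j → P-cong (NP.+-suc i j)))) ⟩
      Σ₀ R a (λ i → H (suc b) * H (a ∸ i) * P i
                    + Σ₀ R b (λ j → H (a ∸ i) * H (b ∸ j) * P (suc (i N.+ j))))
        ≈⟨ Σ₀-distrib-+ a _ _ ⟩
      Σ₀ R a (λ i → H (suc b) * H (a ∸ i) * P i) + shifted-lhs a b
        ≈⟨ +-congʳ (Σ₀-*-newton (H (suc b)) a) ⟩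
      H (suc b) * (fromℕ R (suc a) * H a) + shifted-lhs a b ∎
      where
      P-cong : ∀ {u v k l} → k ≡ l → u * v * P k ≈ u * v * P l
      P-cong k≡l = reflexive (≡.cong (λ k → _ * _ * P k) k≡l)
      column : ∀ i → H (a ∸ i) * H (suc b) * P (i N.+ 0) ≈ H (suc b) * H (a ∸ i) * P i
      column i = trans (P-cong (NP.+-identityʳ i)) (*-congʳ (*-comm _ _))

    peeled-row peeled-column : ℕ → ℕ → Carrier
    peeled-column a b = H (suc b) * (fromℕ R (suc a) * H a)
    peeled-row a b = H (suc a) * (fromℕ R (suc b) * H b)

    lhs-recurrence : ∀ a b → lhs (suc a) b + peeled-column a b ≈ lhs a (suc b) + peeled-row a b
    lhs-recurrence a b = begin
      lhs (suc a) b + peeled-column a b                       ≈⟨ +-congʳ (lhs-sucˡ a b) ⟩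
      (peeled-row a b + shifted-lhs a b) + peeled-column a b  ≈⟨ [x+y]+z≈[z+y]+x _ _ _ ⟩
      (peeled-column a b + shifted-lhs a b) + peeled-row a b  ≈⟨ +-congʳ (lhs-sucʳ a b) ⟨
      lhs a (suc b) + peeled-row a b                          ∎
      where
      [x+y]+z≈[z+y]+x : ∀ x y z → (x + y) + z ≈ (z + y) + x
      [x+y]+z≈[z+y]+x = solve 3 (λ x y z → (x :+ y) :+ z := (z :+ y) :+ x) refl

    rhs-recurrence : ∀ a b → rhs (suc a) b + peeled-column a b ≈ rhs a (suc b) + peeled-row a b
    rhs-recurrence a b = begin
      rhs (suc a) b + peeled-column a b
        ≈⟨ +-congʳ (+-congˡ (trans (Σ₁-head a _) (+-cong first-term (Σ₁-cong a later-term)))) ⟩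
      (fromℕ R (suc b) * H (suc a) * H b + (c * H a * H (suc b) + T)) + peeled-column a b
        ≈⟨ regroup _ _ _ _ _ _ _ _ ⟩
      ((c + fromℕ R (suc a)) * H a * H (suc b) + T) + peeled-row a b
        ≈⟨ +-congʳ (+-congʳ (*-congʳ (*-congʳ c+a+1≈b+2))) ⟩
      rhs a (suc b) + peeled-row a b ∎
      where
      c T : Carrier
      c = fromℤ R (κ (suc a) b 1)
      T = Σ₁ R a (λ i → fromℤ R (κ a (suc b) i) * H (a ∸ i) * H (suc b N.+ i))
      first-term : c * H a * H (b N.+ 1) ≈ c * H a * H (suc b)
      first-term = reflexive (≡.cong (λ k → c * H a * H k) (NP.+-comm b 1))
      later-term : ∀ i → fromℤ R (κ (suc a) b (suc i)) * H (a ∸ i) * H (b N.+ suc i)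
                       ≈ fromℤ R (κ a (suc b) i) * H (a ∸ i) * H (suc b N.+ i)
      later-term i = reflexive (≡.cong₂ (λ z k → fromℤ R z * H (a ∸ i) * H k) (κ-suc-suc a b i) (NP.+-suc b i))
      c+a+1≈b+2 : c + fromℕ R (suc a) ≈ fromℕ R (suc (suc b))
      c+a+1≈b+2 = trans (+-congʳ (reflexive (≡.cong (fromℤ R) (κ-suc-one a b)))) (fromℤ-m-n+n (suc (suc b)) (suc a))
      regroup : ∀ Fb A₁ B c A B₁ T Fa →
                (Fb * A₁ * B + (c * A * B₁ + T)) + B₁ * (Fa * A) ≈ ((c + Fa) * A * B₁ + T) + A₁ * (Fb * B)
      regroup = solve 8 (λ Fb A₁ B c A B₁ T Fa →
                  (Fb :* A₁ :* B :+ (c :* A :* B₁ :+ T)) :+ B₁ :* (Fa :* A)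
                  := ((c :+ Fa) :* A :* B₁ :+ T) :+ A₁ :* (Fb :* B)) refl

    lhs≈rhs : ∀ a b → lhs a b ≈ rhs a b
    lhs≈rhs = recurrence-unique lhs rhs peeled-column peeled-row lhs-recurrence rhs-recurrence λ b →
      trans (Σ₀-*-newton (H 0) b) (trans (x*[y*z]≈y*x*z _ _ _) (sym (+-identityʳ _)))
      where
      x*[y*z]≈y*x*z : ∀ x y z → x * (y * z) ≈ y * x * z
      x*[y*z]≈y*x*z = solve 3 (λ x y z → x :* (y :* z) := y :* x :* z) refl

lemma4p2 : ∀ {c ℓ} (R : CommutativeRing c ℓ) (n : ℕ) (x : Fin n → CommutativeRing.Carrier R) (a b : ℕ) →
    let open CommutativeRing R in
    Σ₀ R a (λ i → Σ₀ R b (λ j → h R n x (a ∸ i) * h R n x (b ∸ j) * p R n x (i Data.Nat.+ j)))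
      ≈ fromℕ R (Data.Nat.suc b) * h R n x a * h R n x b
        + Σ₁ R a (λ i → fromℤ R ((+ b) ℤ.- (+ a) ℤ.+ (+ (2 Data.Nat.* i))) * h R n x (a ∸ i) * h R n x (b Data.Nat.+ i))
lemma4p2 R n x a b = lhs≈rhs R (h R n x) (p R n x) (newton-identity R n x) a b
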